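{- Let $K_{p,q}$ be the complete bipartite graph with parts of sizes $p\le q$, on $n=p+q$ vertices. Then: (1) if $p,q>2$, then $K_{p,q}$ has no canonical ESD labeling; (2) if $p=2$, then $K_{p,q}$ has exactly one canonical ESD labeling up to isomorphism; (3) if $p=1$, then every canonical labeling (every bijection $V(K_{1,q})\to\{1,\dots,n\}$) is an ESD labeling.
   Context: For a graph $G=(V,E)$ and $l\in\mathbb N$, a vertex labeling $\phi:V\to\{1,\dots,l\}$ is an edge-sum distinguishing (ESD) labeling if $\phi$ is injective and the edge-weights $w_\phi(uv)=\phi(u)+\phi(v)$ are pairwise distinct over all edges $uv\in E$. It is a canonical ESD labeling if $l=|V|$. Two vertex labelings $\phi_1,\phi_2$ of $G$ are isomorphic if there is an automorphism $f$ of $G$ with $\phi_1(v)=\phi_2(f(v))$ for all $v\in V(G)$. -}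

module Defs where

open import Data.Nat using (ℕ; _+_; _≤_; _<_)
open import Data.Fin using (Fin; toℕ)
open import Data.Product using (_×_; Σ; _,_)
open import Data.Sum using (_⊎_)
open import Relation.Binary.PropositionalEquality using (_≡_)
open import Relation.Nullary using (¬_)
open import Function.Definitions using (Injective; Bijective)
open import Level using (0ℓ)

record Graph : Set₁ where
  field
    n     : ℕ
    Adj   : Fin n → Fin n → Set
    sym   : ∀ {u v} → Adj u v → Adj v u
    irrefl : ∀ {u} → ¬ Adj u u
open Graph public

InRange : ℕ → ℕ → Set
InRange l k = 1 ≤ k × k ≤ l

IsESD : (G : Graph) → ℕ → (Fin (n G) → ℕ) → Set
IsESD G l φ =
  (∀ v → InRange l (φ v)) ×
  Injective _≡_ _≡_ φ ×
  (∀ u v x y → Adj G u v → Adj G x y → φ u + φ v ≡ φ x + φ y →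
     (u ≡ x × v ≡ y) ⊎ (u ≡ y × v ≡ x))

IsCanonicalESD : (G : Graph) → (Fin (n G) → ℕ) → Set
IsCanonicalESD G φ = IsESD G (n G) φ

-- Canonical labeling: a bijection V → {1,…,|V|} (i.e. injective with
-- values in {1..|V|}, which for finite sets of equal size is a bijection).
IsCanonicalLabeling : (G : Graph) → (Fin (n G) → ℕ) → Set
IsCanonicalLabeling G φ = (∀ v → InRange (n G) (φ v)) × Injective _≡_ _≡_ φ

IsAutomorphism : (G : Graph) → (Fin (n G) → Fin (n G)) → Set
IsAutomorphism G f =
  Bijective _≡_ _≡_ f ×
  (∀ u v → (Adj G u v → Adj G (f u) (f v)) × (Adj G (f u) (f v) → Adj G u v))

IsomorphicLabelings : (G : Graph) → (Fin (n G) → ℕ) → (Fin (n G) → ℕ) → Set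
IsomorphicLabelings G φ₁ φ₂ =
  Σ (Fin (n G) → Fin (n G)) λ f → IsAutomorphism G f × (∀ v → φ₁ v ≡ φ₂ (f v))

KAdj : (p q : ℕ) → Fin (p + q) → Fin (p + q) → Set
KAdj p q u v = (toℕ u < p × p ≤ toℕ v) ⊎ (p ≤ toℕ u × toℕ v < p)

private
  open import Data.Sum using (inj₁; inj₂)
  open import Data.Nat.Properties using (<-irrefl; ≤-trans; <⇒≤)
  open import Relation.Binary.PropositionalEquality using (refl)

  KAdj-sym : ∀ p q {u v} → KAdj p q u v → KAdj p q v u
  KAdj-sym p q (inj₁ (a , b)) = inj₂ (b , a)
  KAdj-sym p q (inj₂ (a , b)) = inj₁ (b , a)

  KAdj-irrefl : ∀ p q {u} → ¬ KAdj p q u u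
  KAdj-irrefl p q (inj₁ (a , b)) = <-irrefl refl (≤-trans a b)
  KAdj-irrefl p q (inj₂ (b , a)) = <-irrefl refl (≤-trans a b)

K : ℕ → ℕ → Graph
K p q = record
  { n = p + q
  ; Adj = KAdj p q
  ; sym = KAdj-sym p q
  ; irrefl = KAdj-irrefl p q
  }

module Submission where

-- Everything rests on one reformulation: writing the edges of K_{p,q} as pairs (i, j) of a left
-- vertex i ↑ˡ q and a right vertex p ↑ʳ j, an injective labeling ψ is ESD iff the weight map
-- (i, j) ↦ ψ(i ↑ˡ q) + ψ(p ↑ʳ j) is injective (esd⇒weight-injective, weight-injective⇒esd).
-- Together with basic facts on canonical labelings (they are onto {1..N}, and any two differ by
-- a permutation) this gives the three parts of the theorem:
--  (3) p = 1: in a star all edges share the centre, so injectivity of ψ is enough.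
--  (1) p ≥ 3: the pq distinct weights lie in [3, 2N), so pq ≤ 2(p + q) − 3, which for 3 ≤ p ≤ q
--      forces p = q = 3; K_{3,3} is then excluded by an exhaustive check of all 6⁶ labelings.
--  (2) p = 2: the left labels a < b = a + δ must leave no free labels c, c + δ (else two edges
--      have weight a + c + δ); for q ≥ 2 this forces {a, b} = {1, N} or N = 4 and {a, b} = {2, 3}.
--      So every ESD labeling puts the end labels 1, N on one side, and the permutation relating
--      it to the extremal labeling (ends on the left, middle labels on the right) preserves or
--      swaps the sides, hence is an automorphism of K_{2,q}.

open import Defs hiding (sym)
open import Data.Bool using (Bool; true; false; not; _∨_)
open import Data.Bool.Properties using (∨-zeroʳ; not-injective)
open import Data.Nat using (ℕ; zero; suc; _+_; _*_; _∸_; _≤_; _<_; _<?_; z≤n; s≤s)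
open import Data.Nat.Properties
open import Data.Nat.Tactic.RingSolver using (solve-∀)
open import Data.Fin using (Fin; #_; toℕ; fromℕ<; reduce≥; _↑ˡ_; _↑ʳ_; join; punchOut; remQuot; combine)
  renaming (zero to fzero; suc to fsuc)
open import Data.Fin.Properties
  using (all?; any?; toℕ-fromℕ<; toℕ<n; toℕ-injective; toℕ-↑ˡ; toℕ-↑ʳ; ↑ˡ-injective; ↑ʳ-injective;
         splitAt-<; splitAt-≥; join-splitAt; punchOut-injective; injective⇒≤; combine-remQuot)
  renaming (_≟_ to _≟ᶠ_)
open import Data.List using (map; allFin; cartesianProduct)
open import Data.List.Properties using (map-cong)
open import Data.List.Relation.Unary.Unique.Propositional using (Unique)
import Data.List.Relation.Unary.Unique.Propositional.Properties as Unique
open import Data.List.Relation.Unary.Unique.DecPropositional _≟_ using (unique?)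
open import Data.Vec using (Vec; lookup; tabulate; _∷_; [])
open import Data.Vec.Properties using (lookup∘tabulate)
open import Data.Product using (_×_; Σ; _,_; proj₁; proj₂; uncurry)
open import Data.Sum using (_⊎_; inj₁; inj₂)
open import Data.Empty using (⊥; ⊥-elim)
open import Function.Base using (id; _∘_)
open import Function.Bundles using (_⇔_; mk⇔; Equivalence)
open import Function.Definitions using (Injective; Bijective)
open import Function.Consequences.Propositional using (strictlySurjective⇒surjective)
open import Relation.Binary.Definitions using (tri<; tri≈; tri>)
open import Relation.Binary.PropositionalEquality
open import Relation.Nullary using (¬_; Dec; ¬?; does; yes; no; contradiction)
open import Relation.Nullary.Decidable using (dec-true; dec-false; _×-dec_; toWitness)

CanonicalOn : (N : ℕ) → (Fin N → ℕ) → Set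
CanonicalOn N ψ = (∀ v → InRange N (ψ v)) × Injective _≡_ _≡_ ψ

label-code : ∀ {N k} → InRange N k → Σ (Fin N) λ i → k ≡ suc (toℕ i)
label-code {k = suc k} (_ , k<N) = fromℕ< k<N , cong suc (sym (toℕ-fromℕ< k<N))

fin-injective⇒onto : ∀ {N} (g : Fin N → Fin N) → Injective _≡_ _≡_ g →
                     ∀ i → Σ (Fin N) λ v → g v ≡ i
fin-injective⇒onto {suc M} g g-inj i with any? (λ v → g v ≟ᶠ i)
... | yes hit = hit
... | no miss = contradiction (injective⇒≤ squeeze-injective) (1+n≰n {M})
  where
  squeeze : Fin (suc M) → Fin M
  squeeze v = punchOut {i = i} {j = g v} (λ i≡gv → miss (v , sym i≡gv))
  squeeze-injective : Injective _≡_ _≡_ squeeze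
  squeeze-injective e = g-inj (punchOut-injective {i = i} _ _ e)

canonical-code : ∀ {N} {ψ : Fin N → ℕ} → CanonicalOn N ψ →
  Σ (Fin N → Fin N) λ g → Injective _≡_ _≡_ g × (∀ v → ψ v ≡ suc (toℕ (g v)))
canonical-code (range , ψ-inj) = g , g-injective , λ v → proj₂ (label-code (range v))
  where
  g : _ → _
  g v = proj₁ (label-code (range v))
  g-injective : Injective _≡_ _≡_ g
  g-injective {u} {v} e = ψ-inj (trans (proj₂ (label-code (range u)))
                          (trans (cong (suc ∘ toℕ) e) (sym (proj₂ (label-code (range v))))))

canonical-onto : ∀ {N} {ψ : Fin N → ℕ} → CanonicalOn N ψ →
                 ∀ {k} → InRange N k → Σ (Fin N) λ v → ψ v ≡ k
canonical-onto ψ-can k-range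
  with g , g-inj , ψ≡g ← canonical-code ψ-can
     | i , k≡i ← label-code k-range
  with v , gv≡i ← fin-injective⇒onto g g-inj i
  = v , trans (ψ≡g v) (trans (cong (suc ∘ toℕ) gv≡i) (sym k≡i))

canonical-transport : ∀ {N} {ψ φ : Fin N → ℕ} → CanonicalOn N ψ → CanonicalOn N φ →
  Σ (Fin N → Fin N) λ f → Bijective _≡_ _≡_ f × (∀ v → ψ v ≡ φ (f v))
canonical-transport {ψ = ψ} {φ} ψ-can φ-can = f , (f-injective , f-surjective) , ψ≡φ∘f
  where
  f : _ → _
  f v = proj₁ (canonical-onto φ-can (proj₁ ψ-can v))
  ψ≡φ∘f : ∀ v → ψ v ≡ φ (f v)
  ψ≡φ∘f v = sym (proj₂ (canonical-onto φ-can (proj₁ ψ-can v)))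
  f-injective : Injective _≡_ _≡_ f
  f-injective {u} {v} e = proj₂ ψ-can (trans (ψ≡φ∘f u) (trans (cong φ e) (sym (ψ≡φ∘f v))))
  f-surjective = strictlySurjective⇒surjective λ w →
    let x , ψx≡φw = canonical-onto ψ-can (proj₁ φ-can w)
    in x , proj₂ φ-can (trans (sym (ψ≡φ∘f x)) ψx≡φw)

inLeft : ∀ p {q} → Fin (p + q) → Bool
inLeft p u = does (toℕ u <? p)

inLeft-true : ∀ p {q} {u : Fin (p + q)} → toℕ u < p → inLeft p u ≡ true
inLeft-true p {u = u} = dec-true (toℕ u <? p)

inLeft-false : ∀ p {q} {u : Fin (p + q)} → ¬ toℕ u < p → inLeft p u ≡ false
inLeft-false p {u = u} = dec-false (toℕ u <? p)

adjacent⇔different-sides : ∀ p q {u v} → KAdj p q u v ⇔ (inLeft p u ≢ inLeft p v)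
adjacent⇔different-sides p q {u} {v} = mk⇔ to from
  where
  true≢false : ∀ {x y : Bool} → x ≡ true → y ≡ false → x ≢ y
  true≢false refl refl ()
  to : KAdj p q u v → inLeft p u ≢ inLeft p v
  to (inj₁ (u<p , p≤v)) = true≢false (inLeft-true p u<p) (inLeft-false p (≤⇒≯ p≤v))
  to (inj₂ (p≤u , v<p)) = ≢-sym (true≢false (inLeft-true p v<p) (inLeft-false p (≤⇒≯ p≤u)))
  from : inLeft p u ≢ inLeft p v → KAdj p q u v
  from different with toℕ u <? p | toℕ v <? p
  ... | yes u<p | yes v<p = contradiction (trans (inLeft-true p u<p) (sym (inLeft-true p v<p))) different
  ... | yes u<p | no  v≮p = inj₁ (u<p , ≮⇒≥ v≮p)
  ... | no  u≮p | yes v<p = inj₂ (≮⇒≥ u≮p , v<p)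
  ... | no  u≮p | no  v≮p = contradiction (trans (inLeft-false p u≮p) (sym (inLeft-false p v≮p))) different

side-respecting-automorphism : ∀ p q (f : Fin (p + q) → Fin (p + q)) (g : Bool → Bool) →
  Injective _≡_ _≡_ g → Bijective _≡_ _≡_ f → (∀ v → inLeft p (f v) ≡ g (inLeft p v)) →
  IsAutomorphism (K p q) f
side-respecting-automorphism p q f g g-inj f-bij f-sides = f-bij , λ u v → preserve u v , reflect u v
  where
  open Equivalence
  preserve : ∀ u v → KAdj p q u v → KAdj p q (f u) (f v)
  preserve u v uv = from (adjacent⇔different-sides p q) λ same →
    to (adjacent⇔different-sides p q) uv (g-inj (trans (sym (f-sides u)) (trans same (f-sides v))))
  reflect : ∀ u v → KAdj p q (f u) (f v) → KAdj p q u v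
  reflect u v fufv = from (adjacent⇔different-sides p q) λ same →
    to (adjacent⇔different-sides p q) fufv (trans (f-sides u) (trans (cong g same) (sym (f-sides v))))

weight : ∀ p q → (Fin (p + q) → ℕ) → Fin p × Fin q → ℕ
weight p q ψ (i , j) = ψ (i ↑ˡ q) + ψ (p ↑ʳ j)

left-right-adjacent : ∀ p q (i : Fin p) (j : Fin q) → KAdj p q (i ↑ˡ q) (p ↑ʳ j)
left-right-adjacent p q i j =
  inj₁ (subst (_< p) (sym (toℕ-↑ˡ i q)) (toℕ<n i) , subst (p ≤_) (sym (toℕ-↑ʳ p j)) (m≤m+n p (toℕ j)))

left≢right : ∀ p q (i : Fin p) (j : Fin q) → i ↑ˡ q ≢ p ↑ʳ j
left≢right p q i j e = irrefl (K p q) (subst (KAdj p q (i ↑ˡ q)) (sym e) (left-right-adjacent p q i j))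

left-label≢right-label : ∀ p q {ψ : Fin (p + q) → ℕ} → Injective _≡_ _≡_ ψ →
                         ∀ i j → ψ (i ↑ˡ q) ≢ ψ (p ↑ʳ j)
left-label≢right-label p q ψ-inj i j e = left≢right p q i j (ψ-inj e)

as-left : ∀ p q (u : Fin (p + q)) → toℕ u < p → Σ (Fin p) λ i → u ≡ i ↑ˡ q
as-left p q u u<p = fromℕ< u<p , trans (sym (join-splitAt p q u)) (cong (join p q) (splitAt-< p u u<p))

as-right : ∀ p q (u : Fin (p + q)) → p ≤ toℕ u → Σ (Fin q) λ j → u ≡ p ↑ʳ j
as-right p q u p≤u = reduce≥ u p≤u , trans (sym (join-splitAt p q u)) (cong (join p q) (splitAt-≥ p u p≤u))

left-or-right : ∀ p q (u : Fin (p + q)) → (Σ (Fin p) λ i → u ≡ i ↑ˡ q) ⊎ (Σ (Fin q) λ j → u ≡ p ↑ʳ j)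
left-or-right p q u with toℕ u <? p
... | yes u<p = inj₁ (as-left p q u u<p)
... | no  u≮p = inj₂ (as-right p q u (≮⇒≥ u≮p))

right-label : ∀ p q {ψ} → CanonicalOn (p + q) ψ → ∀ {c} → InRange (p + q) c →
              (∀ i → ψ (i ↑ˡ q) ≢ c) → Σ (Fin q) λ j → ψ (p ↑ʳ j) ≡ c
right-label p q ψ-can c-range not-left with v , ψv≡c ← canonical-onto ψ-can c-range | left-or-right p q v
... | inj₁ (i , refl) = contradiction ψv≡c (not-left i)
... | inj₂ (j , refl) = j , ψv≡c

Edge : ∀ p q → Fin (p + q) → Fin (p + q) → Fin p × Fin q → Set
Edge p q u v (i , j) = (u ≡ i ↑ˡ q × v ≡ p ↑ʳ j) ⊎ (u ≡ p ↑ʳ j × v ≡ i ↑ˡ q)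

edge-ends : ∀ p q {u v} → KAdj p q u v → Σ (Fin p × Fin q) (Edge p q u v)
edge-ends p q {u} {v} (inj₁ (u<p , p≤v))
  with i , u≡i ← as-left p q u u<p | j , v≡j ← as-right p q v p≤v = (i , j) , inj₁ (u≡i , v≡j)
edge-ends p q {u} {v} (inj₂ (p≤u , v<p))
  with i , v≡i ← as-left p q v v<p | j , u≡j ← as-right p q u p≤u = (i , j) , inj₂ (u≡j , v≡i)

edge-weight : ∀ p q (ψ : Fin (p + q) → ℕ) {u v} e → Edge p q u v e → ψ u + ψ v ≡ weight p q ψ e
edge-weight p q ψ (i , j) (inj₁ (refl , refl)) = refl
edge-weight p q ψ (i , j) (inj₂ (refl , refl)) = +-comm (ψ (p ↑ʳ j)) (ψ (i ↑ˡ q))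

same-edge : ∀ p q {u v x y} e → Edge p q u v e → Edge p q x y e → (u ≡ x × v ≡ y) ⊎ (u ≡ y × v ≡ x)
same-edge p q e (inj₁ (refl , refl)) (inj₁ (refl , refl)) = inj₁ (refl , refl)
same-edge p q e (inj₁ (refl , refl)) (inj₂ (refl , refl)) = inj₂ (refl , refl)
same-edge p q e (inj₂ (refl , refl)) (inj₁ (refl , refl)) = inj₂ (refl , refl)
same-edge p q e (inj₂ (refl , refl)) (inj₂ (refl , refl)) = inj₁ (refl , refl)

esd⇒weight-injective : ∀ p q {l ψ} → IsESD (K p q) l ψ → Injective _≡_ _≡_ (weight p q ψ)
esd⇒weight-injective p q (_ , _ , sums-distinct) {i , j} {i′ , j′} same
  with sums-distinct _ _ _ _ (left-right-adjacent p q i j) (left-right-adjacent p q i′ j′) same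
... | inj₁ (i≡i′ , j≡j′) = cong₂ _,_ (↑ˡ-injective q i i′ i≡i′) (↑ʳ-injective p j j′ j≡j′)
... | inj₂ (i≡j′ , _)    = contradiction i≡j′ (left≢right p q i j′)

weight-injective⇒esd : ∀ p q {l ψ} → (∀ v → InRange l (ψ v)) → Injective _≡_ _≡_ ψ →
  Injective _≡_ _≡_ (weight p q ψ) → IsESD (K p q) l ψ
weight-injective⇒esd p q {ψ = ψ} range ψ-inj w-inj = range , ψ-inj , sums-distinct
  where
  sums-distinct : ∀ u v x y → KAdj p q u v → KAdj p q x y → ψ u + ψ v ≡ ψ x + ψ y →
                  (u ≡ x × v ≡ y) ⊎ (u ≡ y × v ≡ x)
  sums-distinct u v x y uv xy same
    with e , uv-e ← edge-ends p q uv | e′ , xy-e′ ← edge-ends p q xy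
    with refl ← w-inj (trans (sym (edge-weight p q ψ e uv-e)) (trans same (edge-weight p q ψ e′ xy-e′)))
    = same-edge p q e uv-e xy-e′

-- In a star K_{1,q} every edge contains the centre, so distinct leaves give distinct weights.
star-weight-injective : ∀ q {ψ : Fin (1 + q) → ℕ} → Injective _≡_ _≡_ ψ → Injective _≡_ _≡_ (weight 1 q ψ)
star-weight-injective q {ψ} ψ-inj {fzero , j} {fzero , j′} same =
  cong (fzero ,_) (↑ʳ-injective 1 j j′ (ψ-inj (+-cancelˡ-≡ (ψ fzero) _ _ same)))

distinct-labels-sum : ∀ {l a b} → InRange l a → InRange l b → a ≢ b → 3 ≤ a + b × a + b < l + l
distinct-labels-sum {l} {a} {b} (1≤a , a≤l) (1≤b , b≤l) a≢b = lower 1≤a 1≤b a≢b , upper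
  where
  lower : ∀ {a b} → 1 ≤ a → 1 ≤ b → a ≢ b → 3 ≤ a + b
  lower {1} {1} _ _ a≢b = contradiction refl a≢b
  lower {1} {suc (suc b)} _ _ _ = s≤s (s≤s (s≤s z≤n))
  lower {suc (suc a)} {suc b} _ _ _ = s≤s (s≤s (≤-trans (s≤s z≤n) (m≤n+m (suc b) a)))
  upper : a + b < l + l
  upper with m≤n⇒m<n∨m≡n a≤l | m≤n⇒m<n∨m≡n b≤l
  ... | inj₁ a<l | _         = +-mono-<-≤ a<l b≤l
  ... | inj₂ refl | inj₁ b<l = +-monoʳ-< a b<l
  ... | inj₂ refl | inj₂ refl = contradiction refl a≢b

injective-in-window : ∀ {m lo hi} (f : Fin m → ℕ) → Injective _≡_ _≡_ f →
                      (∀ i → lo ≤ f i × f i < hi) → m ≤ hi ∸ lo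
injective-in-window {m} {lo} {hi} f f-inj bounds = injective⇒≤ offset-injective
  where
  offset : Fin m → Fin (hi ∸ lo)
  offset i = fromℕ< (∸-monoˡ-< (proj₂ (bounds i)) (proj₁ (bounds i)))
  offset-injective : Injective _≡_ _≡_ offset
  offset-injective {i} {j} e = f-inj (∸-cancelʳ-≡ (proj₁ (bounds i)) (proj₁ (bounds j))
    (trans (sym (toℕ-fromℕ< _)) (trans (cong toℕ e) (toℕ-fromℕ< _))))

edge-count : ∀ p q {ψ} → IsCanonicalESD (K p q) ψ → p * q ≤ (p + q) + (p + q) ∸ 3
edge-count p q {ψ} esd@(range , ψ-inj , _) = injective-in-window (weight p q ψ ∘ remQuot q) w-inj bounds
  where
  w-inj : Injective _≡_ _≡_ (weight p q ψ ∘ remQuot q)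
  w-inj {s} {t} e = trans (sym (combine-remQuot {p} q s))
                    (trans (cong (uncurry combine) (esd⇒weight-injective p q esd e)) (combine-remQuot {p} q t))
  bounds : ∀ t → 3 ≤ weight p q ψ (remQuot q t) × weight p q ψ (remQuot q t) < (p + q) + (p + q)
  bounds t = distinct-labels-sum (range _) (range _) (left-label≢right-label p q ψ-inj _ _)

K33-excess : ∀ a b → (3 + a) * ((3 + a) + b) + 3 ≡
  ((3 + a) + ((3 + a) + b)) + ((3 + a) + ((3 + a) + b)) + (a + (a + (b + (a * a + a * b))))
K33-excess = solve-∀

no-excess : ∀ a b → let p = 3 + a; q = p + b in p * q ≤ (p + q) + (p + q) ∸ 3 → a ≡ 0 × b ≡ 0
no-excess a b count = m+n≡0⇒m≡0 a excess≡0 , m+n≡0⇒m≡0 b (m+n≡0⇒n≡0 a (m+n≡0⇒n≡0 a excess≡0))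
  where
  open ≤-Reasoning
  p = 3 + a
  q = p + b
  excess = a + (a + (b + (a * a + a * b)))
  twice-sum = (p + q) + (p + q)
  excess≡0 : excess ≡ 0
  excess≡0 = n≤0⇒n≡0 (+-cancelˡ-≤ twice-sum _ 0 (begin
      twice-sum + excess  ≡⟨ sym (K33-excess a b) ⟩
      p * q + 3           ≤⟨ m≤o∸n⇒m+n≤o (p * q) (m≤m+n 3 ((a + q) + (p + q))) count ⟩
      twice-sum           ≡⟨ sym (+-identityʳ twice-sum) ⟩
      twice-sum + 0       ∎))

only-K33 : ∀ p q → 3 ≤ p → p ≤ q → p * q ≤ (p + q) + (p + q) ∸ 3 → p ≡ 3 × q ≡ 3
only-K33 p q 3≤p p≤q count
  with a , refl ← m≤n⇒∃[o]m+o≡n 3≤p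
  with b , refl ← m≤n⇒∃[o]m+o≡n p≤q
  with refl , refl ← no-excess a b count
  = refl , refl

ListedESD : ∀ p q → (Fin (p + q) → ℕ) → Set
ListedESD p q ψ = Unique (map ψ (allFin (p + q))) ×
                  Unique (map (weight p q ψ) (cartesianProduct (allFin p) (allFin q)))

listedESD? : ∀ p q ψ → Dec (ListedESD p q ψ)
listedESD? p q ψ = unique? _ ×-dec unique? _

esd⇒listed : ∀ p q {l ψ} → IsESD (K p q) l ψ → ListedESD p q ψ
esd⇒listed p q esd@(_ , ψ-inj , _) =
  Unique.map⁺ ψ-inj (Unique.allFin⁺ (p + q)) ,
  Unique.map⁺ (esd⇒weight-injective p q esd) (Unique.cartesianProduct⁺ (Unique.allFin⁺ p) (Unique.allFin⁺ q))

listed-cong : ∀ p q {ψ ψ′} → ψ ≗ ψ′ → ListedESD p q ψ → ListedESD p q ψ′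
listed-cong p q ψ≗ψ′ (labels , weights) =
  subst Unique (map-cong ψ≗ψ′ _) labels ,
  subst Unique (map-cong (λ { (i , j) → cong₂ _+_ (ψ≗ψ′ (i ↑ˡ q)) (ψ≗ψ′ (p ↑ʳ j)) }) _) weights

tuple-labeling : Vec (Fin 6) 6 → Fin 6 → ℕ
tuple-labeling xs v = suc (toℕ (lookup xs v))

no-listed-K33 : ∀ a b c d e f → ¬ ListedESD 3 3 (tuple-labeling (a ∷ b ∷ c ∷ d ∷ e ∷ f ∷ []))
no-listed-K33 = toWitness {a? = all? λ a → all? λ b → all? λ c → all? λ d → all? λ e → all? λ f →
                              ¬? (listedESD? 3 3 (tuple-labeling (a ∷ b ∷ c ∷ d ∷ e ∷ f ∷ [])))} _

K33-no-ESD : ∀ ψ → ¬ IsCanonicalESD (K 3 3) ψ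
K33-no-ESD ψ esd@(range , ψ-inj , _)
  with g , _ , ψ≡g ← canonical-code (range , ψ-inj)
  = no-listed-K33 (g (# 0)) (g (# 1)) (g (# 2)) (g (# 3)) (g (# 4)) (g (# 5))
      (listed-cong 3 3 (λ v → trans (ψ≡g v) (cong (suc ∘ toℕ) (sym (lookup∘tabulate g v)))) (esd⇒listed 3 3 esd))

-- The left labels a and a + δ of K_{2,q} are shift-free on {1..N} when no c ≥ 1 with c + δ ≤ N
-- has both c and c + δ outside {a, a + δ} (that c + δ ≢ a + δ already follows from c ≢ a).
ShiftFree : (N a δ : ℕ) → Set
ShiftFree N a δ = ∀ c → 1 ≤ c → c + δ ≤ N → c ≢ a → c ≢ a + δ → c + δ ≢ a → ⊥

Extremal : (N a b : ℕ) → Set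
Extremal N a b = (a ≡ 1 × b ≡ N) ⊎ (a ≡ 2 × b ≡ 3 × N ≡ 4)

-- Shift-free left labels are extremal, writing a = 1 + a′, δ = 1 + d and N = a + δ + m.
-- Each non-extremal case is refuted by one witness c:
--   a = 1, m ≠ δ: c = 1 + m (so c + δ = N);    a = 1, m = δ: c = 2 (N ≥ 4 forces δ ≥ 2);
--   a ≥ 2, a ≠ 1 + δ: c = 1;                    a = 1 + δ, m = 0: c = δ (again δ ≥ 2);
--   a = 1 + δ, m ≠ δ: c = a + m (so c + δ = N); a = 1 + δ = m + 1: c = 2 unless δ = 1, N = 4.
shift-free⇒extremal′ : ∀ a′ d m → let N = suc a′ + suc d + m in
  4 ≤ N → ShiftFree N (suc a′) (suc d) → Extremal N (suc a′) (suc a′ + suc d)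
shift-free⇒extremal′ zero d zero _ _ = inj₁ (refl , sym (+-identityʳ _))
shift-free⇒extremal′ zero d (suc m′) 4≤N shift-free with m′ ≟ d
... | no m′≢d = ⊥-elim (shift-free (2 + m′) (s≤s z≤n) (≤-reflexive (c+δ≡N m′ d)) (λ ())
                         (m′≢d ∘ suc-injective ∘ suc-injective) (λ ()))
  where
  c+δ≡N : ∀ m′ d → 2 + m′ + suc d ≡ 1 + suc d + suc m′
  c+δ≡N = solve-∀
shift-free⇒extremal′ zero zero (suc .zero) (s≤s (s≤s (s≤s ()))) _ | yes refl
shift-free⇒extremal′ zero (suc e) (suc .(suc e)) _ shift-free | yes refl =
  ⊥-elim (shift-free 2 (s≤s z≤n) (s≤s (s≤s (s≤s (≤-trans (n≤1+n (suc e)) (m≤n+m (suc (suc e)) e)))))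
                     (λ ()) (λ ()) (λ ()))
shift-free⇒extremal′ (suc a″) d m 4≤N shift-free with d ≟ a″
... | no d≢a″ = ⊥-elim (shift-free 1 (s≤s z≤n) (s≤s (≤-trans (m≤n+m (suc d) (suc a″)) (m≤m+n _ m)))
                         (λ ()) (λ ()) (d≢a″ ∘ suc-injective ∘ suc-injective))
shift-free⇒extremal′ (suc zero) zero zero (s≤s (s≤s (s≤s ()))) _ | yes refl
shift-free⇒extremal′ (suc (suc e)) (suc e) zero _ shift-free | yes refl =
  ⊥-elim (shift-free (2 + e) (s≤s z≤n) (≤-trans (n≤1+n _) (≤-reflexive (sym (+-identityʳ _))))
                     (≢-sym 1+n≢n) (<⇒≢ (s≤s (m≤m+n (2 + e) (2 + e))))
                     (m+1+n≢n e ∘ suc-injective ∘ suc-injective))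
shift-free⇒extremal′ (suc d) d (suc m′) _ shift-free | yes refl with m′ ≟ d
... | no m′≢d = ⊥-elim (shift-free (2 + d + suc m′) (s≤s z≤n) (≤-reflexive (c+δ≡N d m′)) (m+1+n≢m (2 + d))
                          (m′≢d ∘ suc-injective ∘ +-cancelˡ-≡ (2 + d) _ _)
                          (≢-sym (<⇒≢ (≤-trans (m<m+n (2 + d) (s≤s z≤n)) (m≤m+n _ (suc d))))))
  where
  c+δ≡N : ∀ d m′ → 2 + d + suc m′ + suc d ≡ 2 + d + suc d + suc m′
  c+δ≡N = solve-∀
shift-free⇒extremal′ (suc zero) zero (suc zero) _ _ | yes refl | yes refl = inj₂ (refl , refl , refl)
shift-free⇒extremal′ (suc (suc e)) (suc e) (suc (suc e)) _ shift-free | yes refl | yes refl =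
  ⊥-elim (shift-free 2 (s≤s z≤n)
                     (s≤s (s≤s (s≤s (≤-trans (≤-trans (n≤1+n (suc e)) (m≤n+m (suc (suc e)) e)) (m≤m+n _ _)))))
                     (λ ()) (λ ()) 1+n≢n)

shift-free⇒extremal : ∀ {N a δ} → 4 ≤ N → 1 ≤ a → 1 ≤ δ → a + δ ≤ N → ShiftFree N a δ → Extremal N a (a + δ)
shift-free⇒extremal {a = suc a′} {suc d} 4≤N _ _ b≤N shift-free
  with m , refl ← m≤n⇒∃[o]m+o≡n b≤N = shift-free⇒extremal′ a′ d m 4≤N shift-free

extremal : ∀ q → Fin (2 + q) → ℕ
extremal q fzero           = 1
extremal q (fsuc fzero)    = 2 + q
extremal q (fsuc (fsuc j)) = 2 + toℕ j

extremal-canonical : ∀ q → CanonicalOn (2 + q) (extremal q)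
extremal-canonical q = range , injective
  where
  range : ∀ v → InRange (2 + q) (extremal q v)
  range fzero           = s≤s z≤n , s≤s z≤n
  range (fsuc fzero)    = s≤s z≤n , ≤-refl
  range (fsuc (fsuc j)) = s≤s z≤n , s≤s (s≤s (<⇒≤ (toℕ<n j)))
  middle≢top : ∀ (j : Fin q) → 2 + toℕ j ≢ 2 + q
  middle≢top j e = <⇒≢ (toℕ<n j) (suc-injective (suc-injective e))
  injective : Injective _≡_ _≡_ (extremal q)
  injective {fzero}         {fzero}         _ = refl
  injective {fsuc fzero}    {fsuc fzero}    _ = refl
  injective {fsuc (fsuc j)} {fsuc (fsuc k)} e = cong (fsuc ∘ fsuc) (toℕ-injective (suc-injective (suc-injective e)))
  injective {fsuc fzero}    {fsuc (fsuc k)} e = contradiction (sym e) (middle≢top k)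
  injective {fsuc (fsuc j)} {fsuc fzero}    e = contradiction e (middle≢top j)
  injective {fzero}         {fsuc (fsuc k)} ()
  injective {fsuc (fsuc j)} {fzero}         ()

extremal-low<high : ∀ q (j k : Fin q) → 1 + (2 + toℕ j) < (2 + q) + (2 + toℕ k)
extremal-low<high q j k = ≤-<-trans (s≤s (s≤s (toℕ<n j))) (m<m+n (2 + q) (s≤s z≤n))

extremal-weight-injective : ∀ q → Injective _≡_ _≡_ (weight 2 q (extremal q))
extremal-weight-injective q {fzero , j} {fzero , k} e =
  cong (fzero ,_) (toℕ-injective (+-cancelˡ-≡ 3 _ _ e))
extremal-weight-injective q {fsuc fzero , j} {fsuc fzero , k} e =
  cong (fsuc fzero ,_) (toℕ-injective (suc-injective (suc-injective (+-cancelˡ-≡ (2 + q) _ _ e))))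
extremal-weight-injective q {fzero , j} {fsuc fzero , k} e = contradiction e (<⇒≢ (extremal-low<high q j k))
extremal-weight-injective q {fsuc fzero , j} {fzero , k} e = contradiction e (>⇒≢ (extremal-low<high q k j))

extremal-ESD : ∀ q → IsCanonicalESD (K 2 q) (extremal q)
extremal-ESD q = weight-injective⇒esd 2 q (proj₁ (extremal-canonical q)) (proj₂ (extremal-canonical q))
                                          (extremal-weight-injective q)

avoid-left : ∀ {q} (ψ : Fin (2 + q) → ℕ) {i i′ : Fin 2} {x} → i ≢ i′ →
             x ≢ ψ (i ↑ˡ q) → x ≢ ψ (i′ ↑ˡ q) → ∀ i″ → ψ (i″ ↑ˡ q) ≢ x
avoid-left ψ {fzero}      {fzero}      i≢i′ _   _   _            = contradiction refl i≢i′
avoid-left ψ {fsuc fzero} {fsuc fzero} i≢i′ _   _   _            = contradiction refl i≢i′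
avoid-left ψ {fzero}      {fsuc fzero} _    x≢a x≢b fzero        = ≢-sym x≢a
avoid-left ψ {fzero}      {fsuc fzero} _    x≢a x≢b (fsuc fzero) = ≢-sym x≢b
avoid-left ψ {fsuc fzero} {fzero}      _    x≢a x≢b fzero        = ≢-sym x≢b
avoid-left ψ {fsuc fzero} {fzero}      _    x≢a x≢b (fsuc fzero) = ≢-sym x≢a

-- If the left labels of an ESD labeling of K_{2,q} are a and a + δ, they are shift-free: free labels
-- c and c + δ would sit on right vertices and give the equal weights a + (c + δ) = (a + δ) + c.
left-labels-shift-free : ∀ q {ψ} → IsCanonicalESD (K 2 q) ψ → ∀ {i i′ δ} → i ≢ i′ →
  ψ (i′ ↑ˡ q) ≡ ψ (i ↑ˡ q) + δ → ShiftFree (2 + q) (ψ (i ↑ˡ q)) δ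
left-labels-shift-free q {ψ} esd@(range , ψ-inj , _) {i} {i′} {δ} i≢i′ b≡a+δ c 1≤c c+δ≤N c≢a c≢a+δ c+δ≢a
  with j , ψj≡c   ← right-label 2 q (range , ψ-inj) (1≤c , ≤-trans (m≤m+n c δ) c+δ≤N)
                      (avoid-left ψ i≢i′ c≢a (subst (c ≢_) (sym b≡a+δ) c≢a+δ))
     | k , ψk≡c+δ ← right-label 2 q (range , ψ-inj) (≤-trans 1≤c (m≤m+n c δ) , c+δ≤N)
                      (avoid-left ψ i≢i′ c+δ≢a (subst (c + δ ≢_) (sym b≡a+δ) (c≢a ∘ +-cancelʳ-≡ δ c _)))
  = i≢i′ (cong proj₁ (esd⇒weight-injective 2 q esd (begin
      a + ψ (2 ↑ʳ k)        ≡⟨ cong (a +_) ψk≡c+δ ⟩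
      a + (c + δ)           ≡⟨ cong (a +_) (+-comm c δ) ⟩
      a + (δ + c)           ≡⟨ +-assoc a δ c ⟨
      (a + δ) + c           ≡⟨ cong₂ _+_ b≡a+δ ψj≡c ⟨
      ψ (i′ ↑ˡ q) + ψ (2 ↑ʳ j) ∎)))
  where
  open ≡-Reasoning
  a = ψ (i ↑ˡ q)

ordered-left-labels : ∀ q {ψ} → 2 ≤ q → IsCanonicalESD (K 2 q) ψ → ∀ {i i′} → i ≢ i′ →
  ψ (i ↑ˡ q) < ψ (i′ ↑ˡ q) → Extremal (2 + q) (ψ (i ↑ˡ q)) (ψ (i′ ↑ˡ q))
ordered-left-labels q {ψ} 2≤q esd@(range , _ , _) {i} i≢i′ a<b
  with d , 1+a+d≡b ← m≤n⇒∃[o]m+o≡n a<b =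
  let b≡a+δ = trans (sym 1+a+d≡b) (sym (+-suc (ψ (i ↑ˡ q)) d)) in
  subst (Extremal (2 + q) (ψ (i ↑ˡ q))) (sym b≡a+δ)
    (shift-free⇒extremal (s≤s (s≤s 2≤q)) (proj₁ (range _)) (s≤s z≤n) (subst (_≤ 2 + q) b≡a+δ (proj₂ (range _)))
       (left-labels-shift-free q esd i≢i′ b≡a+δ))

left-labels-extremal : ∀ q {ψ} → 2 ≤ q → IsCanonicalESD (K 2 q) ψ →
  Extremal (2 + q) (ψ fzero) (ψ (fsuc fzero)) ⊎ Extremal (2 + q) (ψ (fsuc fzero)) (ψ fzero)
left-labels-extremal q {ψ} 2≤q esd@(_ , ψ-inj , _) with <-cmp (ψ fzero) (ψ (fsuc fzero))
... | tri< a<b _ _ = inj₁ (ordered-left-labels q 2≤q esd (λ ()) a<b)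
... | tri≈ _ a≡b _ = contradiction (ψ-inj a≡b) λ ()
... | tri> _ _ b<a = inj₂ (ordered-left-labels q 2≤q esd (λ ()) b<a)

isEnd : ℕ → ℕ → Bool
isEnd N k = does (k ≟ 1) ∨ does (k ≟ N)

isEnd-true : ∀ {N k} → k ≡ 1 ⊎ k ≡ N → isEnd N k ≡ true
isEnd-true (inj₁ refl)         = refl
isEnd-true {k = k} (inj₂ refl) = trans (cong (does (k ≟ 1) ∨_) (dec-true (k ≟ k) refl)) (∨-zeroʳ _)

isEnd-false : ∀ {N k} → k ≢ 1 → k ≢ N → isEnd N k ≡ false
isEnd-false {N} {k} k≢1 k≢N rewrite dec-false (k ≟ 1) k≢1 | dec-false (k ≟ N) k≢N = refl

extremal-sides : ∀ q w → inLeft 2 w ≡ isEnd (2 + q) (extremal q w)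
extremal-sides q fzero           = refl
extremal-sides q (fsuc fzero)    = sym (isEnd-true {2 + q} (inj₂ refl))
extremal-sides q (fsuc (fsuc j)) = sym (isEnd-false (λ ()) (<⇒≢ (s≤s (s≤s (toℕ<n j)))))

LeftPair : ∀ {q} → (Fin (2 + q) → ℕ) → ℕ → ℕ → Set
LeftPair ψ x y = (ψ fzero ≡ x × ψ (fsuc fzero) ≡ y) ⊎ (ψ fzero ≡ y × ψ (fsuc fzero) ≡ x)

left-pair-left : ∀ {q} (ψ : Fin (2 + q) → ℕ) {x y} → LeftPair ψ x y → ∀ i → ψ (i ↑ˡ q) ≡ x ⊎ ψ (i ↑ˡ q) ≡ y
left-pair-left _ (inj₁ (a≡x , _)) fzero        = inj₁ a≡x
left-pair-left _ (inj₁ (_ , b≡y)) (fsuc fzero) = inj₂ b≡y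
left-pair-left _ (inj₂ (a≡y , _)) fzero        = inj₂ a≡y
left-pair-left _ (inj₂ (_ , b≡x)) (fsuc fzero) = inj₁ b≡x

left-pair-right : ∀ {q} (ψ : Fin (2 + q) → ℕ) {x y} → Injective _≡_ _≡_ ψ → LeftPair ψ x y →
                  ∀ j → ψ (2 ↑ʳ j) ≢ x × ψ (2 ↑ʳ j) ≢ y
left-pair-right {q} _ ψ-inj (inj₁ (refl , refl)) j =
  ≢-sym (left-label≢right-label 2 q ψ-inj fzero j) , ≢-sym (left-label≢right-label 2 q ψ-inj (fsuc fzero) j)
left-pair-right {q} _ ψ-inj (inj₂ (refl , refl)) j =
  ≢-sym (left-label≢right-label 2 q ψ-inj (fsuc fzero) j) , ≢-sym (left-label≢right-label 2 q ψ-inj fzero j)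

ends-left : ∀ {q} (ψ : Fin (2 + q) → ℕ) → Injective _≡_ _≡_ ψ → LeftPair ψ 1 (2 + q) →
            ∀ v → isEnd (2 + q) (ψ v) ≡ inLeft 2 v
ends-left ψ ψ-inj pair fzero           = isEnd-true (left-pair-left ψ pair fzero)
ends-left ψ ψ-inj pair (fsuc fzero)    = isEnd-true (left-pair-left ψ pair (fsuc fzero))
ends-left ψ ψ-inj pair (fsuc (fsuc j)) = uncurry isEnd-false (left-pair-right ψ ψ-inj pair j)

middle-of-four : ∀ {k} → k ≡ 2 ⊎ k ≡ 3 → isEnd 4 k ≡ false
middle-of-four (inj₁ refl) = refl
middle-of-four (inj₂ refl) = refl

end-of-four : ∀ {k} → InRange 4 k → k ≢ 2 × k ≢ 3 → isEnd 4 k ≡ true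
end-of-four {1} _ _         = refl
end-of-four {2} _ (k≢2 , _) = contradiction refl k≢2
end-of-four {3} _ (_ , k≢3) = contradiction refl k≢3
end-of-four {4} _ _         = refl
end-of-four {suc (suc (suc (suc (suc _))))} (_ , s≤s (s≤s (s≤s (s≤s ())))) _

ends-right : ∀ (ψ : Fin (2 + 2) → ℕ) → CanonicalOn 4 ψ → LeftPair ψ 2 3 →
             ∀ v → isEnd 4 (ψ v) ≡ not (inLeft 2 v)
ends-right ψ _ pair fzero                         = middle-of-four (left-pair-left ψ pair fzero)
ends-right ψ _ pair (fsuc fzero)                  = middle-of-four (left-pair-left ψ pair (fsuc fzero))
ends-right ψ (range , ψ-inj) pair (fsuc (fsuc j)) = end-of-four (range _) (left-pair-right ψ ψ-inj pair j)

end-labels-side : ∀ q {ψ} → 2 ≤ q → IsCanonicalESD (K 2 q) ψ →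
  Σ (Bool → Bool) λ g → Injective _≡_ _≡_ g × (∀ v → isEnd (2 + q) (ψ v) ≡ g (inLeft 2 v))
end-labels-side q {ψ} 2≤q esd@(range , ψ-inj , _) with left-labels-extremal q 2≤q esd
... | inj₁ (inj₁ (a≡1 , b≡N))        = id , id , ends-left ψ ψ-inj (inj₁ (a≡1 , b≡N))
... | inj₂ (inj₁ (b≡1 , a≡N))        = id , id , ends-left ψ ψ-inj (inj₂ (a≡N , b≡1))
... | inj₁ (inj₂ (a≡2 , b≡3 , refl)) = not , not-injective , ends-right ψ (range , ψ-inj) (inj₁ (a≡2 , b≡3))
... | inj₂ (inj₂ (b≡2 , a≡3 , refl)) = not , not-injective , ends-right ψ (range , ψ-inj) (inj₂ (a≡3 , b≡2))

K2-unique : ∀ q → 2 ≤ q → ∀ ψ → IsCanonicalESD (K 2 q) ψ → IsomorphicLabelings (K 2 q) ψ (extremal q)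
K2-unique q 2≤q ψ esd@(range , ψ-inj , _)
  with f , f-bij , ψ≡ext∘f ← canonical-transport (range , ψ-inj) (extremal-canonical q)
     | g , g-inj , ends ← end-labels-side q 2≤q esd
  = f , side-respecting-automorphism 2 q f g g-inj f-bij sides , ψ≡ext∘f
  where
  sides : ∀ v → inLeft 2 (f v) ≡ g (inLeft 2 v)
  sides v = begin
    inLeft 2 (f v)                   ≡⟨ extremal-sides q (f v) ⟩
    isEnd (2 + q) (extremal q (f v)) ≡⟨ cong (isEnd (2 + q)) (ψ≡ext∘f v) ⟨
    isEnd (2 + q) (ψ v)              ≡⟨ ends v ⟩
    g (inLeft 2 v)                   ∎
    where open ≡-Reasoning

theorem4 : (p q : ℕ) → p ≤ q →
    ((2 < p → ¬ Σ (Fin (n (K p q)) → ℕ) (IsCanonicalESD (K p q))) ×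
     (p ≡ 2 → Σ (Fin (n (K p q)) → ℕ) λ φ → IsCanonicalESD (K p q) φ ×
        (∀ ψ → IsCanonicalESD (K p q) ψ → IsomorphicLabelings (K p q) ψ φ))) ×
    (p ≡ 1 → ∀ φ → IsCanonicalLabeling (K p q) φ → IsCanonicalESD (K p q) φ)
theorem4 p q p≤q = (no-ESD , two-unique) , star-ESD
  where
  no-ESD : 2 < p → ¬ Σ (Fin (p + q) → ℕ) (IsCanonicalESD (K p q))
  no-ESD 3≤p (ψ , esd) with refl , refl ← only-K33 p q 3≤p p≤q (edge-count p q esd) = K33-no-ESD ψ esd
  two-unique : p ≡ 2 → Σ (Fin (p + q) → ℕ) λ φ → IsCanonicalESD (K p q) φ ×
                 (∀ ψ → IsCanonicalESD (K p q) ψ → IsomorphicLabelings (K p q) ψ φ)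
  two-unique refl = extremal q , extremal-ESD q , K2-unique q p≤q
  star-ESD : p ≡ 1 → ∀ φ → IsCanonicalLabeling (K p q) φ → IsCanonicalESD (K p q) φ
  star-ESD refl φ (range , φ-inj) = weight-injective⇒esd 1 q range φ-inj (star-weight-injective q φ-inj)
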